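{- Let $\mathcal{Z}$ be a set of positive integers. For every proper subset $\mathcal{Y}\subsetneq\mathcal{Z}$ there exists a normalized totally positive quadratic polynomial that represents every element of $\mathcal{Y}$ but does not represent every element of $\mathcal{Z}$.
   Context: A quadratic polynomial $f\in\mathbb{Q}[x_1,\dots,x_k]$ (for some $k$) is normalized totally positive if $f(\mathbb{Z}^k)$ is contained in the nonnegative integers and $f(x)=0$ for some $x\in\mathbb{Z}^k$. A polynomial $f$ represents $n$ if $f(x)=n$ for some $x\in\mathbb{Z}^k$. -}

module Defs where

open import Data.Nat using (ℕ; zero; suc)
open import Data.Integer using (ℤ; +_)
open import Data.Rational using (ℚ; _/_; _+_; _*_; 0ℚ)
open import Data.Fin using (Fin)
open import Data.Product using (Σ; ∃; _×_)
open import Data.Empty using (⊥)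
open import Relation.Binary.PropositionalEquality using (_≡_)
open import Relation.Nullary using (¬_)

ℤtoℚ : ℤ → ℚ
ℤtoℚ z = z / 1

ℕtoℚ : ℕ → ℚ
ℕtoℚ n = (+ n) / 1

∑ : (k : ℕ) → (Fin k → ℚ) → ℚ
∑ zero    f = 0ℚ
∑ (suc k) f = f Fin.zero + ∑ k (λ i → f (Fin.suc i))

record QuadPoly (k : ℕ) : Set where
  field
    quad  : Fin k → Fin k → ℚ
    lin   : Fin k → ℚ
    const : ℚ
open QuadPoly public

eval : {k : ℕ} → QuadPoly k → (Fin k → ℤ) → ℚ
eval {k} f x =
  ∑ k (λ i → ∑ k (λ j → quad f i j * (ℤtoℚ (x i) * ℤtoℚ (x j))))
  + ∑ k (λ i → lin f i * ℤtoℚ (x i))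
  + const f

-- f is a genuine quadratic polynomial (total degree exactly 2): some degree-2
-- monomial x_i x_j has nonzero coefficient.  The coefficient of x_i x_j is
-- quad i j + quad j i for i ≠ j and quad i i for i = j; in both cases it is
-- nonzero iff quad i j + quad j i ≠ 0.
IsQuadratic : {k : ℕ} → QuadPoly k → Set
IsQuadratic {k} f = ∃ λ (i : Fin k) → ∃ λ (j : Fin k) → ¬ (quad f i j + quad f j i ≡ 0ℚ)

Represents : {k : ℕ} → QuadPoly k → ℕ → Set
Represents {k} f n = ∃ λ (x : Fin k → ℤ) → eval f x ≡ ℕtoℚ n

NormalizedTotallyPositive : {k : ℕ} → QuadPoly k → Set
NormalizedTotallyPositive {k} f =
  ((x : Fin k → ℤ) → ∃ λ (n : ℕ) → eval f x ≡ ℕtoℚ n) × Represents f 0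

module Submission where

-- Proposition 1.4. Given a positive integer z, we construct a normalized totally
-- positive quadratic polynomial F whose set of values is exactly ℕ ∖ {z}; it then
-- represents every element of 𝒴 (which avoids z) but not z ∈ 𝒵.
--
-- For z = t + 1, A = z + 1 and M = A + z, take the separable polynomial
--   F(s, u, w) = A (s₁² + s₂² + s₃² + s₄²) + M u² + Σᵢ₌₁ᵗ (A wᵢ² + (1 - A) wᵢ).
-- Each summand is a natural number: the last ones take the values 0, 1, or ≥ A,
-- so F never takes the value z; conversely, by Lagrange's four-square theorem the
-- first block gives every multiple of A, and residues modulo A are supplied by the w's
-- (residues ≤ t) or by M u² (residue z, needing at least one extra A, so n ≠ z).

open import Defs
open import Data.Nat using (ℕ; _<_)
open import Data.Product using (Σ; ∃; _×_)
open import Relation.Nullary using (¬_)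

open import Data.Nat as ℕ using (zero; suc; z≤n; s≤s; NonZero)
import Data.Nat.Properties as ℕP
import Data.Nat.Divisibility as ℕ∣
import Data.Nat.DivMod as ℕ÷
open import Data.Nat.Primality
  using (Prime; prime; composite; composite?; prime⇒nonZero; prime⇒nonTrivial; euclidsLemma)
open import Data.Nat.Induction using (<-rec)
import Data.Nat.Tactic.RingSolver as ℕ-Ring
open import Data.Integer as ℤ using (ℤ; +_; -[1+_]; ∣_∣; 0ℤ)
import Data.Integer.Properties as ℤP
open import Data.Integer.Divisibility.Signed
  using (_∣_; divides; ∣ᵤ⇒∣; ∣⇒∣ᵤ; ∣-refl; ∣m∣n⇒∣m+n; ∣m+n∣n⇒∣m; ∣n⇒∣m*n; ∣m⇒∣m*n; ∣m⇒∣-m; *-monoʳ-∣; *-cancelˡ-∣)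
import Data.Integer.DivMod as ℤ÷
open import Data.Integer.Tactic.RingSolver using (solve-∀)
open import Data.Rational as ℚ using (ℚ; 0ℚ)
import Data.Rational.Properties as ℚP
import Data.Rational.Unnormalised as ℚᵘ
import Data.Rational.Unnormalised.Properties as ℚᵘP
open import Data.Fin using (Fin; zero; suc; toℕ; fromℕ<; splitAt; join)
import Data.Fin.Properties as FinP
open import Data.Product using (∃₂; _,_)
open import Data.Sum using (_⊎_; inj₁; inj₂; [_,_]′)
open import Data.Empty using (⊥; ⊥-elim)
open import Function using (_∘_)
open import Relation.Nullary using (yes; no)
open import Relation.Binary.PropositionalEquality
open import Relation.Binary.Definitions using (tri<; tri≈; tri>)
open import Algebra.Bundles using (CommutativeMonoid)
import Algebra.Properties.CommutativeSemigroup as CommutativeSemigroupProperties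
import Algebra.Properties.CommutativeMonoid.Sum as MonoidSum

module SquareBounds where
  open import Data.Nat using (_+_; _*_; _≤_)

  square-injective : ∀ a b → a * a ≡ b * b → a ≡ b
  square-injective a b a²≡b² with ℕP.<-cmp a b
  ... | tri< a<b _ _ = ⊥-elim (ℕP.<-irrefl a²≡b² (ℕP.*-mono-< a<b a<b))
  ... | tri≈ _ a≡b _ = a≡b
  ... | tri> _ _ b<a = ⊥-elim (ℕP.<-irrefl (sym a²≡b²) (ℕP.*-mono-< b<a b<a))

  sum-squares-zero : ∀ a₁ a₂ a₃ a₄ → a₁ * a₁ + a₂ * a₂ + a₃ * a₃ + a₄ * a₄ ≡ 0 →
                     a₁ ≡ 0 × a₂ ≡ 0 × a₃ ≡ 0 × a₄ ≡ 0
  sum-squares-zero zero zero zero zero _ = refl , refl , refl , refl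

  +-tight : ∀ {a b c d} → a ≤ b → c ≤ d → a + c ≡ b + d → a ≡ b × c ≡ d
  +-tight {a} {b} {c} {d} a≤b c≤d a+c≡b+d =
    a≡b , ℕP.+-cancelˡ-≡ a c d (trans a+c≡b+d (cong (_+ d) (sym a≡b)))
    where
    b≤a : b ≤ a
    b≤a = ℕP.+-cancelʳ-≤ d b a (subst (_≤ a + d) a+c≡b+d (ℕP.+-monoʳ-≤ a c≤d))
    a≡b = ℕP.≤-antisym a≤b b≤a

  module _ (a₁ a₂ a₃ a₄ : ℕ) {m : ℕ}
           (h₁ : 2 * a₁ ≤ m) (h₂ : 2 * a₂ ≤ m) (h₃ : 2 * a₃ ≤ m) (h₄ : 2 * a₄ ≤ m) where
    private
      S = a₁ * a₁ + a₂ * a₂ + a₃ * a₃ + a₄ * a₄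
      M = m * m

      quadruple : ∀ a₁ a₂ a₃ a₄ → 4 * (a₁ * a₁ + a₂ * a₂ + a₃ * a₃ + a₄ * a₄)
        ≡ 2 * a₁ * (2 * a₁) + 2 * a₂ * (2 * a₂) + 2 * a₃ * (2 * a₃) + 2 * a₄ * (2 * a₄)
      quadruple = ℕ-Ring.solve-∀

      fourfold : ∀ M → 4 * M ≡ M + M + M + M
      fourfold = ℕ-Ring.solve-∀

      sq≤ : ∀ {u} → u ≤ m → u * u ≤ M
      sq≤ u≤m = ℕP.*-mono-≤ u≤m u≤m

    sum-squares-bound : S ≤ M
    sum-squares-bound = ℕP.*-cancelˡ-≤ 4 (begin
      4 * S ≡⟨ quadruple a₁ a₂ a₃ a₄ ⟩
      _     ≤⟨ ℕP.+-mono-≤ (ℕP.+-mono-≤ (ℕP.+-mono-≤ (sq≤ h₁) (sq≤ h₂)) (sq≤ h₃)) (sq≤ h₄) ⟩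
      M + M + M + M ≡⟨ fourfold M ⟨
      4 * M ∎)
      where open ℕP.≤-Reasoning

    sum-squares-extremal : S ≡ M → 2 * a₁ ≡ m × 2 * a₂ ≡ m × 2 * a₃ ≡ m × 2 * a₄ ≡ m
    sum-squares-extremal S≡M =
      let e₁₂₃ , e₄ = +-tight (ℕP.+-mono-≤ (ℕP.+-mono-≤ (sq≤ h₁) (sq≤ h₂)) (sq≤ h₃)) (sq≤ h₄) sum≡
          e₁₂ , e₃  = +-tight (ℕP.+-mono-≤ (sq≤ h₁) (sq≤ h₂)) (sq≤ h₃) e₁₂₃
          e₁ , e₂   = +-tight (sq≤ h₁) (sq≤ h₂) e₁₂
      in root e₁ , root e₂ , root e₃ , root e₄
      where
      sum≡ : 2 * a₁ * (2 * a₁) + 2 * a₂ * (2 * a₂) + 2 * a₃ * (2 * a₃) + 2 * a₄ * (2 * a₄)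
             ≡ M + M + M + M
      sum≡ = trans (sym (quadruple a₁ a₂ a₃ a₄)) (trans (cong (4 *_) S≡M) (fourfold M))
      root : ∀ {u} → u * u ≡ M → u ≡ m
      root {u} = square-injective u m

  two-squares-plus-one-bound : ∀ a b {p} → 2 * a ≤ p → 2 * b ≤ p → 2 ≤ p → a * a + b * b + 1 < p * p
  two-squares-plus-one-bound a b {p} 2a≤p 2b≤p 2≤p = ℕP.*-cancelˡ-< 4 _ _ (begin-strict
    4 * (a * a + b * b + 1)               ≡⟨ quadruple a b ⟩
    2 * a * (2 * a) + 2 * b * (2 * b) + 4 ≤⟨ ℕP.+-monoˡ-≤ 4 (ℕP.+-mono-≤ (square≤ 2a≤p) (square≤ 2b≤p)) ⟩
    p * p + p * p + 4                     <⟨ ℕP.+-monoʳ-< (p * p + p * p) 4<2p² ⟩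
    p * p + p * p + (p * p + p * p)       ≡⟨ fourfold (p * p) ⟨
    4 * (p * p)                           ∎)
    where
    open ℕP.≤-Reasoning
    quadruple : ∀ a b → 4 * (a * a + b * b + 1) ≡ 2 * a * (2 * a) + 2 * b * (2 * b) + 4
    quadruple = ℕ-Ring.solve-∀
    fourfold : ∀ M → 4 * M ≡ M + M + (M + M)
    fourfold = ℕ-Ring.solve-∀
    square≤ : ∀ {u} → u ≤ p → u * u ≤ p * p
    square≤ u≤p = ℕP.*-mono-≤ u≤p u≤p
    4<2p² : 4 < p * p + p * p
    4<2p² = ℕP.≤-<-trans (ℕP.*-mono-≤ 2≤p 2≤p)
              (ℕP.m<m+n (p * p) (ℕP.*-mono-< (ℕP.<-≤-trans ℕP.0<1+n 2≤p) (ℕP.<-≤-trans ℕP.0<1+n 2≤p)))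

module FourSquares where
  open SquareBounds
  open import Data.Integer using (_+_; _*_; -_; _-_)

  -- Integer quadruples, manipulated as integral quaternions: coordinatewise sum and
  -- scalar multiple, dot product, norm and the product x·ȳ.
  record ℤ⁴ : Set where
    constructor ⟨_,_,_,_⟩
    field c₁ c₂ c₃ c₄ : ℤ

  infixl 6 _⊕_
  infixl 7 _·_ _⊗_ _∙_
  infix 4 _∣⁴_

  _⊕_ : ℤ⁴ → ℤ⁴ → ℤ⁴
  ⟨ a₁ , a₂ , a₃ , a₄ ⟩ ⊕ ⟨ b₁ , b₂ , b₃ , b₄ ⟩ = ⟨ a₁ + b₁ , a₂ + b₂ , a₃ + b₃ , a₄ + b₄ ⟩

  _·_ : ℤ → ℤ⁴ → ℤ⁴
  m · ⟨ a₁ , a₂ , a₃ , a₄ ⟩ = ⟨ m * a₁ , m * a₂ , m * a₃ , m * a₄ ⟩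

  _∙_ : ℤ⁴ → ℤ⁴ → ℤ
  ⟨ a₁ , a₂ , a₃ , a₄ ⟩ ∙ ⟨ b₁ , b₂ , b₃ , b₄ ⟩ = a₁ * b₁ + a₂ * b₂ + a₃ * b₃ + a₄ * b₄

  ‖_‖ : ℤ⁴ → ℤ
  ‖ a ‖ = a ∙ a

  -- The quaternion product x·ȳ, written in coordinates.
  _⊗_ : ℤ⁴ → ℤ⁴ → ℤ⁴
  ⟨ x₁ , x₂ , x₃ , x₄ ⟩ ⊗ ⟨ y₁ , y₂ , y₃ , y₄ ⟩ =
    ⟨ x₁ * y₁ + x₂ * y₂ + x₃ * y₃ + x₄ * y₄
    , x₁ * y₂ - x₂ * y₁ + x₃ * y₄ - x₄ * y₃
    , x₁ * y₃ - x₃ * y₁ + x₄ * y₂ - x₂ * y₄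
    , x₁ * y₄ - x₄ * y₁ + x₂ * y₃ - x₃ * y₂ ⟩

  ⟨⟩-cong : ∀ {a₁ a₂ a₃ a₄ b₁ b₂ b₃ b₄} → a₁ ≡ b₁ → a₂ ≡ b₂ → a₃ ≡ b₃ → a₄ ≡ b₄ →
            ⟨ a₁ , a₂ , a₃ , a₄ ⟩ ≡ ⟨ b₁ , b₂ , b₃ , b₄ ⟩
  ⟨⟩-cong refl refl refl refl = refl

  euler-identity : ∀ x₁ x₂ x₃ x₄ y₁ y₂ y₃ y₄ →
    (x₁ * x₁ + x₂ * x₂ + x₃ * x₃ + x₄ * x₄) * (y₁ * y₁ + y₂ * y₂ + y₃ * y₃ + y₄ * y₄)
    ≡ (x₁ * y₁ + x₂ * y₂ + x₃ * y₃ + x₄ * y₄) * (x₁ * y₁ + x₂ * y₂ + x₃ * y₃ + x₄ * y₄)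
    + (x₁ * y₂ - x₂ * y₁ + x₃ * y₄ - x₄ * y₃) * (x₁ * y₂ - x₂ * y₁ + x₃ * y₄ - x₄ * y₃)
    + (x₁ * y₃ - x₃ * y₁ + x₄ * y₂ - x₂ * y₄) * (x₁ * y₃ - x₃ * y₁ + x₄ * y₂ - x₂ * y₄)
    + (x₁ * y₄ - x₄ * y₁ + x₂ * y₃ - x₃ * y₂) * (x₁ * y₄ - x₄ * y₁ + x₂ * y₃ - x₃ * y₂)
  euler-identity = solve-∀

  ‖‖-⊗ : ∀ x y → ‖ x ‖ * ‖ y ‖ ≡ ‖ x ⊗ y ‖
  ‖‖-⊗ ⟨ x₁ , x₂ , x₃ , x₄ ⟩ ⟨ y₁ , y₂ , y₃ , y₄ ⟩ = euler-identity x₁ x₂ x₃ x₄ y₁ y₂ y₃ y₄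

  ‖‖-· : ∀ m a → ‖ m · a ‖ ≡ m * m * ‖ a ‖
  ‖‖-· m ⟨ a₁ , a₂ , a₃ , a₄ ⟩ = identity m a₁ a₂ a₃ a₄
    where
    identity : ∀ m a₁ a₂ a₃ a₄ →
      m * a₁ * (m * a₁) + m * a₂ * (m * a₂) + m * a₃ * (m * a₃) + m * a₄ * (m * a₄)
      ≡ m * m * (a₁ * a₁ + a₂ * a₂ + a₃ * a₃ + a₄ * a₄)
    identity = solve-∀

  ‖‖-⊕· : ∀ y m k → ‖ y ⊕ m · k ‖ ≡ ‖ y ‖ + m * (k ∙ (+ 2 · y)) + m * m * ‖ k ‖
  ‖‖-⊕· ⟨ y₁ , y₂ , y₃ , y₄ ⟩ m ⟨ k₁ , k₂ , k₃ , k₄ ⟩ = identity y₁ y₂ y₃ y₄ m k₁ k₂ k₃ k₄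
    where
    identity : ∀ y₁ y₂ y₃ y₄ m k₁ k₂ k₃ k₄ →
      (y₁ + m * k₁) * (y₁ + m * k₁) + (y₂ + m * k₂) * (y₂ + m * k₂)
      + (y₃ + m * k₃) * (y₃ + m * k₃) + (y₄ + m * k₄) * (y₄ + m * k₄)
      ≡ y₁ * y₁ + y₂ * y₂ + y₃ * y₃ + y₄ * y₄
      + m * (k₁ * (+ 2 * y₁) + k₂ * (+ 2 * y₂) + k₃ * (+ 2 * y₃) + k₄ * (+ 2 * y₄))
      + m * m * (k₁ * k₁ + k₂ * k₂ + k₃ * k₃ + k₄ * k₄)
    identity = solve-∀

  ⊗-shift : ∀ y m k r → ‖ y ‖ ≡ m * r →
            m · (⟨ r , 0ℤ , 0ℤ , 0ℤ ⟩ ⊕ k ⊗ y) ≡ (y ⊕ m · k) ⊗ y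
  ⊗-shift ⟨ y₁ , y₂ , y₃ , y₄ ⟩ m ⟨ k₁ , k₂ , k₃ , k₄ ⟩ r ‖y‖≡mr =
    ⟨⟩-cong real (imaginary y₁ y₂ y₃ y₄ k₁ k₂ k₃ k₄)
                 (imaginary y₁ y₃ y₄ y₂ k₁ k₃ k₄ k₂) (imaginary y₁ y₄ y₂ y₃ k₁ k₄ k₂ k₃)
    where
    open ≡-Reasoning
    K = k₁ * y₁ + k₂ * y₂ + k₃ * y₃ + k₄ * y₄
    real-identity : ∀ y₁ y₂ y₃ y₄ m k₁ k₂ k₃ k₄ →
      y₁ * y₁ + y₂ * y₂ + y₃ * y₃ + y₄ * y₄ + m * (k₁ * y₁ + k₂ * y₂ + k₃ * y₃ + k₄ * y₄)
      ≡ (y₁ + m * k₁) * y₁ + (y₂ + m * k₂) * y₂ + (y₃ + m * k₃) * y₃ + (y₄ + m * k₄) * y₄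
    real-identity = solve-∀
    real : m * (r + K) ≡ (y₁ + m * k₁) * y₁ + (y₂ + m * k₂) * y₂ + (y₃ + m * k₃) * y₃ + (y₄ + m * k₄) * y₄
    real = begin
      m * (r + K)       ≡⟨ ℤP.*-distribˡ-+ m r K ⟩
      m * r + m * K     ≡⟨ cong (_+ m * K) ‖y‖≡mr ⟨
      ‖ ⟨ y₁ , y₂ , y₃ , y₄ ⟩ ‖ + m * K ≡⟨ real-identity y₁ y₂ y₃ y₄ m k₁ k₂ k₃ k₄ ⟩
      _ ∎
    imaginary : ∀ a b c d k₁ k₂ k₃ k₄ →
      m * (0ℤ + (k₁ * b - k₂ * a + k₃ * d - k₄ * c))
      ≡ (a + m * k₁) * b - (b + m * k₂) * a + (c + m * k₃) * d - (d + m * k₄) * c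
    imaginary a b c d k₁ k₂ k₃ k₄ = identity a b c d k₁ k₂ k₃ k₄ m
      where
      identity : ∀ a b c d k₁ k₂ k₃ k₄ m →
        m * (0ℤ + (k₁ * b - k₂ * a + k₃ * d - k₄ * c))
        ≡ (a + m * k₁) * b - (b + m * k₂) * a + (c + m * k₃) * d - (d + m * k₄) * c
      identity = solve-∀

  -- Euler's descent identity: if m ≠ 0, ‖ y + m k ‖ = m P and ‖ y ‖ = m R, then
  -- R P is again a sum of four squares, namely the norm of (y + m k)·ȳ / m.
  euler-descent : ∀ m .{{_ : ℤ.NonZero m}} P R y k → ‖ y ⊕ m · k ‖ ≡ m * P → ‖ y ‖ ≡ m * R →
                  ‖ ⟨ R , 0ℤ , 0ℤ , 0ℤ ⟩ ⊕ k ⊗ y ‖ ≡ R * P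
  euler-descent m P R y k ‖x‖≡mP ‖y‖≡mR = ℤP.*-cancelˡ-≡ (m * m) _ _ {{ℤP.i*j≢0 m m}} (begin
    m * m * ‖ w ‖          ≡⟨ ‖‖-· m w ⟨
    ‖ m · w ‖              ≡⟨ cong ‖_‖ (⊗-shift y m k R ‖y‖≡mR) ⟩
    ‖ (y ⊕ m · k) ⊗ y ‖    ≡⟨ ‖‖-⊗ (y ⊕ m · k) y ⟨
    ‖ y ⊕ m · k ‖ * ‖ y ‖  ≡⟨ cong₂ _*_ ‖x‖≡mP ‖y‖≡mR ⟩
    m * P * (m * R)        ≡⟨ rearrange m P R ⟩
    m * m * (R * P)        ∎)
    where
    open ≡-Reasoning
    w = ⟨ R , 0ℤ , 0ℤ , 0ℤ ⟩ ⊕ k ⊗ y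
    rearrange : ∀ m P R → m * P * (m * R) ≡ m * m * (R * P)
    rearrange = solve-∀

  Each : (ℤ → Set) → ℤ⁴ → Set
  Each P ⟨ a₁ , a₂ , a₃ , a₄ ⟩ = P a₁ × P a₂ × P a₃ × P a₄

  _∣⁴_ : ℤ → ℤ⁴ → Set
  m ∣⁴ v = Each (m ∣_) v

  ∙-∣ : ∀ {m} k v → m ∣⁴ v → m ∣ k ∙ v
  ∙-∣ ⟨ k₁ , k₂ , k₃ , k₄ ⟩ ⟨ _ , _ , _ , _ ⟩ (m∣v₁ , m∣v₂ , m∣v₃ , m∣v₄) =
    ∣m∣n⇒∣m+n (∣m∣n⇒∣m+n (∣m∣n⇒∣m+n (∣n⇒∣m*n k₁ m∣v₁) (∣n⇒∣m*n k₂ m∣v₂))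
                                    (∣n⇒∣m*n k₃ m∣v₃)) (∣n⇒∣m*n k₄ m∣v₄)

  ‖‖-⊕·-∣ : ∀ y m k → m ∣ ‖ y ⊕ m · k ‖ → m ∣ ‖ y ‖
  ‖‖-⊕·-∣ y m k m∣‖x‖ rewrite ‖‖-⊕· y m k =
    ∣m+n∣n⇒∣m (∣m+n∣n⇒∣m m∣‖x‖ (∣m⇒∣m*n ‖ k ‖ (∣m⇒∣m*n m ∣-refl)))
              (∣m⇒∣m*n (k ∙ (+ 2 · y)) ∣-refl)

  ‖‖-⊕·-∣² : ∀ y m k → m ∣⁴ (+ 2 · y) → m * m ∣ ‖ y ‖ → m * m ∣ ‖ y ⊕ m · k ‖
  ‖‖-⊕·-∣² y m k m∣2y m²∣‖y‖ rewrite ‖‖-⊕· y m k =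
    ∣m∣n⇒∣m+n (∣m∣n⇒∣m+n m²∣‖y‖ (*-monoʳ-∣ m (∙-∣ k (+ 2 · y) m∣2y)))
              (∣m⇒∣m*n ‖ k ‖ ∣-refl)

  ‖_‖ₙ : ℤ⁴ → ℕ
  ‖ ⟨ a₁ , a₂ , a₃ , a₄ ⟩ ‖ₙ =
    ∣ a₁ ∣ ℕ.* ∣ a₁ ∣ ℕ.+ ∣ a₂ ∣ ℕ.* ∣ a₂ ∣ ℕ.+ ∣ a₃ ∣ ℕ.* ∣ a₃ ∣ ℕ.+ ∣ a₄ ∣ ℕ.* ∣ a₄ ∣

  square≡∣∣² : ∀ a → a * a ≡ + (∣ a ∣ ℕ.* ∣ a ∣)
  square≡∣∣² (+ n)    = sym (ℤP.pos-* n n)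
  square≡∣∣² -[1+ n ] = refl

  ‖‖≡‖‖ₙ : ∀ a → ‖ a ‖ ≡ + ‖ a ‖ₙ
  ‖‖≡‖‖ₙ ⟨ a₁ , a₂ , a₃ , a₄ ⟩ = begin
    a₁ * a₁ + a₂ * a₂ + a₃ * a₃ + a₄ * a₄
      ≡⟨ cong₂ _+_ (cong₂ _+_ (cong₂ _+_ (square≡∣∣² a₁) (square≡∣∣² a₂)) (square≡∣∣² a₃)) (square≡∣∣² a₄) ⟩
    + s₁ + + s₂ + + s₃ + + s₄ ≡⟨ cong (λ t → t + + s₃ + + s₄) (ℤP.pos-+ s₁ s₂) ⟨
    + (s₁ ℕ.+ s₂) + + s₃ + + s₄ ≡⟨ cong (_+ + s₄) (ℤP.pos-+ (s₁ ℕ.+ s₂) s₃) ⟨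
    + (s₁ ℕ.+ s₂ ℕ.+ s₃) + + s₄ ≡⟨ ℤP.pos-+ (s₁ ℕ.+ s₂ ℕ.+ s₃) s₄ ⟨
    + (s₁ ℕ.+ s₂ ℕ.+ s₃ ℕ.+ s₄) ∎
    where
    open ≡-Reasoning
    s₁ = ∣ a₁ ∣ ℕ.* ∣ a₁ ∣
    s₂ = ∣ a₂ ∣ ℕ.* ∣ a₂ ∣
    s₃ = ∣ a₃ ∣ ℕ.* ∣ a₃ ∣
    s₄ = ∣ a₄ ∣ ℕ.* ∣ a₄ ∣

  balanced-remainder : ∀ m .{{_ : NonZero m}} x → ∃₂ λ y k → x ≡ y + + m * k × 2 ℕ.* ∣ y ∣ ℕ.≤ m
  balanced-remainder m x = balance (x ℤ.%ℕ m) (x ℤ./ℕ m) (ℤ÷.a≡a%ℕn+[a/ℕn]*n x m) (ℤ÷.n%ℕd<d x m)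
    where
    balance : ∀ ρ q → x ≡ + ρ + q * + m → ρ ℕ.< m → ∃₂ λ y k → x ≡ y + + m * k × 2 ℕ.* ∣ y ∣ ℕ.≤ m
    balance ρ q x≡ρ+qm ρ<m with 2 ℕ.* ρ ℕ.≤? m
    ... | yes 2ρ≤m = + ρ , q , trans x≡ρ+qm (cong (λ t → + ρ + t) (ℤP.*-comm q (+ m))) , 2ρ≤m
    ... | no 2ρ≰m = - + e , q + + 1 , x≡ , 2e≤m
      where
      e = m ℕ.∸ ρ
      ρ+e≡m : ρ ℕ.+ e ≡ m
      ρ+e≡m = ℕP.m+[n∸m]≡n (ℕP.<⇒≤ ρ<m)
      shift : ∀ r s q → r + q * (r + s) ≡ - s + (r + s) * (q + + 1)
      shift = solve-∀
      x≡ : x ≡ - + e + + m * (q + + 1)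
      x≡ = begin
        x                               ≡⟨ x≡ρ+qm ⟩
        + ρ + q * + m                   ≡⟨ cong (λ t → + ρ + q * t) m≡ρ+e ⟩
        + ρ + q * (+ ρ + + e)           ≡⟨ shift (+ ρ) (+ e) q ⟩
        - + e + (+ ρ + + e) * (q + + 1) ≡⟨ cong (λ t → - + e + t * (q + + 1)) m≡ρ+e ⟨
        - + e + + m * (q + + 1)         ∎
        where
        open ≡-Reasoning
        m≡ρ+e : + m ≡ + ρ + + e
        m≡ρ+e = trans (cong +_ (sym ρ+e≡m)) (ℤP.pos-+ ρ e)
      e≤ρ : e ℕ.≤ ρ
      e≤ρ = ℕP.+-cancelˡ-≤ ρ e ρ (ℕP.<⇒≤ (subst (ℕ._< ρ ℕ.+ ρ) (sym ρ+e≡m)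
              (subst (m ℕ.<_) (cong (ρ ℕ.+_) (ℕP.+-identityʳ ρ)) (ℕP.≰⇒> 2ρ≰m))))
      2e≤m : 2 ℕ.* ∣ - + e ∣ ℕ.≤ m
      2e≤m rewrite ℤP.∣-i∣≡∣i∣ (+ e) | ℕP.+-identityʳ e = begin
        e ℕ.+ e ≤⟨ ℕP.+-monoʳ-≤ e e≤ρ ⟩
        e ℕ.+ ρ ≡⟨ trans (ℕP.+-comm e ρ) ρ+e≡m ⟩
        m       ∎
        where open ℕP.≤-Reasoning

  Small : ℕ → ℤ⁴ → Set
  Small m = Each (λ a → 2 ℕ.* ∣ a ∣ ℕ.≤ m)

  balanced-remainder⁴ : ∀ m .{{_ : NonZero m}} x → ∃₂ λ y k → x ≡ y ⊕ + m · k × Small m y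
  balanced-remainder⁴ m ⟨ x₁ , x₂ , x₃ , x₄ ⟩ =
    let y₁ , k₁ , e₁ , s₁ = balanced-remainder m x₁
        y₂ , k₂ , e₂ , s₂ = balanced-remainder m x₂
        y₃ , k₃ , e₃ , s₃ = balanced-remainder m x₃
        y₄ , k₄ , e₄ , s₄ = balanced-remainder m x₄
    in ⟨ y₁ , y₂ , y₃ , y₄ ⟩ , ⟨ k₁ , k₂ , k₃ , k₄ ⟩ , ⟨⟩-cong e₁ e₂ e₃ e₄ , s₁ , s₂ , s₃ , s₄

  ‖‖ₙ-bound : ∀ {m} y → Small m y → ‖ y ‖ₙ ℕ.≤ m ℕ.* m
  ‖‖ₙ-bound ⟨ a₁ , a₂ , a₃ , a₄ ⟩ (s₁ , s₂ , s₃ , s₄) =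
    sum-squares-bound (∣ a₁ ∣) (∣ a₂ ∣) (∣ a₃ ∣) (∣ a₄ ∣) s₁ s₂ s₃ s₄

  ‖‖ₙ-degenerate : ∀ {m} y → Small m y → ‖ y ‖ₙ ≡ 0 ⊎ ‖ y ‖ₙ ≡ m ℕ.* m →
                   Each (λ a → m ℕ∣.∣ 2 ℕ.* ∣ a ∣) y
  ‖‖ₙ-degenerate {m} ⟨ a₁ , a₂ , a₃ , a₄ ⟩ _ (inj₁ ‖y‖≡0) =
    let z₁ , z₂ , z₃ , z₄ = sum-squares-zero (∣ a₁ ∣) (∣ a₂ ∣) (∣ a₃ ∣) (∣ a₄ ∣) ‖y‖≡0
    in divides-0 z₁ , divides-0 z₂ , divides-0 z₃ , divides-0 z₄
    where
    divides-0 : ∀ {n} → n ≡ 0 → m ℕ∣.∣ 2 ℕ.* n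
    divides-0 refl = m ℕ∣.∣0
  ‖‖ₙ-degenerate ⟨ a₁ , a₂ , a₃ , a₄ ⟩ (s₁ , s₂ , s₃ , s₄) (inj₂ ‖y‖≡m²) =
    let e₁ , e₂ , e₃ , e₄ = sum-squares-extremal (∣ a₁ ∣) (∣ a₂ ∣) (∣ a₃ ∣) (∣ a₄ ∣) s₁ s₂ s₃ s₄ ‖y‖≡m²
    in ℕ∣.∣-reflexive (sym e₁) , ℕ∣.∣-reflexive (sym e₂) , ℕ∣.∣-reflexive (sym e₃) , ℕ∣.∣-reflexive (sym e₄)

  twice-∣ : ∀ {m} y → Each (λ a → m ℕ∣.∣ 2 ℕ.* ∣ a ∣) y → + m ∣⁴ (+ 2 · y)
  twice-∣ ⟨ a₁ , a₂ , a₃ , a₄ ⟩ (d₁ , d₂ , d₃ , d₄) = lift a₁ d₁ , lift a₂ d₂ , lift a₃ d₃ , lift a₄ d₄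
    where
    lift : ∀ {m} a → m ℕ∣.∣ 2 ℕ.* ∣ a ∣ → + m ∣ + 2 * a
    lift {m} a d = ∣ᵤ⇒∣ (subst (m ℕ∣.∣_) (sym (ℤP.abs-* (+ 2) a)) d)

  FourSquares : ℕ → Set
  FourSquares n = ∃ λ x → ‖ x ‖ ≡ + n

  module Descent {p : ℕ} (p-prime : Prime p) where

    no-proper-divisor : ∀ {m} → 1 ℕ.< m → m ℕ.< p → ¬ (m ℕ∣.∣ p)
    no-proper-divisor {suc zero}    (s≤s ())
    no-proper-divisor {suc (suc _)} _ m<p m∣p = Prime.notComposite p-prime (composite m<p m∣p)

    -- Euler's descent step, for x = y + m k already reduced modulo m: from a
    -- representation of m p (1 < m < p) as a sum of four squares, obtain one of
    -- r p for some 0 < r < m, where m r = ‖ y ‖.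
    reduced-descent : ∀ {m} → 1 ℕ.< m → m ℕ.< p → ∀ y k → Small m y →
                      ‖ y ⊕ + m · k ‖ ≡ + m * + p → ∃ λ r → 0 ℕ.< r × r ℕ.< m × FourSquares (r ℕ.* p)
    reduced-descent {m} 1<m m<p y k y-small ‖y+mk‖≡mp =
      descend (ℕ∣._∣_.quotient m∣‖y‖ₙ) (ℕ∣._∣_.equality m∣‖y‖ₙ)
      where
      instance
        m≢0 : NonZero m
        m≢0 = ℕ.>-nonZero (ℕP.<-trans ℕP.0<1+n 1<m)
      m∣‖y‖ₙ : m ℕ∣.∣ ‖ y ‖ₙ
      m∣‖y‖ₙ = subst (λ t → m ℕ∣.∣ ∣ t ∣) (‖‖≡‖‖ₙ y)
        (∣⇒∣ᵤ (‖‖-⊕·-∣ y (+ m) k (divides (+ p) (trans ‖y+mk‖≡mp (ℤP.*-comm (+ m) (+ p))))))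

      -- If ‖ y ‖ is 0 or m², then m² divides ‖ y + m k ‖ = m p, making m a proper divisor of p.
      degenerate : ∀ {r} → ‖ y ‖ₙ ≡ r ℕ.* m → ‖ y ‖ₙ ≡ 0 ⊎ ‖ y ‖ₙ ≡ m ℕ.* m → m ℕ∣.∣ r → ⊥
      degenerate ‖y‖ₙ≡rm extreme m∣r = no-proper-divisor 1<m m<p (∣⇒∣ᵤ (*-cancelˡ-∣ (+ m) m²∣mp))
        where
        m²∣‖y‖ : + m * + m ∣ ‖ y ‖
        m²∣‖y‖ = subst₂ _∣_ (ℤP.pos-* m m) (sym (trans (‖‖≡‖‖ₙ y) (cong +_ ‖y‖ₙ≡rm)))
                   (∣ᵤ⇒∣ (ℕ∣.*-monoˡ-∣ m m∣r))
        m²∣mp : + m * + m ∣ + m * + p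
        m²∣mp = subst (+ m * + m ∣_) ‖y+mk‖≡mp
                  (‖‖-⊕·-∣² y (+ m) k (twice-∣ y (‖‖ₙ-degenerate y y-small extreme)) m²∣‖y‖)

      descend : ∀ r → ‖ y ‖ₙ ≡ r ℕ.* m → ∃ λ r → 0 ℕ.< r × r ℕ.< m × FourSquares (r ℕ.* p)
      descend r ‖y‖ₙ≡rm with r ℕ.≟ 0 | r ℕ.≟ m
      ... | yes refl | _        = ⊥-elim (degenerate ‖y‖ₙ≡rm (inj₁ ‖y‖ₙ≡rm) (m ℕ∣.∣0))
      ... | no _     | yes refl = ⊥-elim (degenerate ‖y‖ₙ≡rm (inj₂ ‖y‖ₙ≡rm) ℕ∣.∣-refl)
      ... | no r≢0  | no r≢m  = r , ℕP.n≢0⇒n>0 r≢0 , ℕP.≤∧≢⇒< r≤m r≢m ,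
            ⟨ + r , 0ℤ , 0ℤ , 0ℤ ⟩ ⊕ k ⊗ y ,
            trans (euler-descent (+ m) (+ p) (+ r) y k ‖y+mk‖≡mp ‖y‖≡mr) (sym (ℤP.pos-* r p))
        where
        r≤m : r ℕ.≤ m
        r≤m = ℕP.*-cancelʳ-≤ r m m (subst (ℕ._≤ m ℕ.* m) ‖y‖ₙ≡rm (‖‖ₙ-bound y y-small))
        ‖y‖≡mr : ‖ y ‖ ≡ + m * + r
        ‖y‖≡mr = trans (‖‖≡‖‖ₙ y) (trans (cong +_ (trans ‖y‖ₙ≡rm (ℕP.*-comm r m))) (ℤP.pos-* m r))

    descent-step : ∀ {m} → 1 ℕ.< m → m ℕ.< p → FourSquares (m ℕ.* p) →
                   ∃ λ r → 0 ℕ.< r × r ℕ.< m × FourSquares (r ℕ.* p)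
    descent-step {m@(suc _)} 1<m m<p (x , ‖x‖≡mp) with balanced-remainder⁴ m x
    ... | y , k , refl , y-small = reduced-descent 1<m m<p y k y-small (trans ‖x‖≡mp (ℤP.pos-* m p))

    descent : ∀ m → 0 ℕ.< m → m ℕ.< p → FourSquares (m ℕ.* p) → FourSquares p
    descent = <-rec (λ m → 0 ℕ.< m → m ℕ.< p → FourSquares (m ℕ.* p) → FourSquares p) step
      where
      step : ∀ m → (∀ {r} → r ℕ.< m → 0 ℕ.< r → r ℕ.< p → FourSquares (r ℕ.* p) → FourSquares p) →
             0 ℕ.< m → m ℕ.< p → FourSquares (m ℕ.* p) → FourSquares p
      step (suc zero)      _   _ _   (x , ‖x‖≡p) = x , trans ‖x‖≡p (cong +_ (ℕP.*-identityˡ p))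
      step (suc (suc _))   rec _ m<p m·p =
        let r , 0<r , r<m , r·p = descent-step (s≤s (s≤s z≤n)) m<p m·p
        in rec r<m 0<r (ℕP.<-trans r<m m<p) r·p

  -- For a prime p, some a, b ≤ p/2 satisfy a² + b² + 1 ≡ 0 (mod p): among the p + 1
  -- numbers a² and -(1 + b²) two are congruent modulo p, and they cannot both be of
  -- the same kind.
  module Pigeonhole {p : ℕ} (p-prime : Prime p) where
    instance
      p≢0 : NonZero p
      p≢0 = prime⇒nonZero p-prime

    2≤p : 2 ℕ.≤ p
    2≤p = ℕ.nonTrivial⇒n>1 p {{prime⇒nonTrivial p-prime}}

    same-residue : ∀ x y → x ℤ.%ℕ p ≡ y ℤ.%ℕ p → + p ∣ x - y
    same-residue x y eq = divides (x ℤ./ℕ p - y ℤ./ℕ p) (begin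
      x - y ≡⟨ cong₂ _-_ (ℤ÷.a≡a%ℕn+[a/ℕn]*n x p) (ℤ÷.a≡a%ℕn+[a/ℕn]*n y p) ⟩
      (+ (x ℤ.%ℕ p) + x ℤ./ℕ p * + p) - (+ (y ℤ.%ℕ p) + y ℤ./ℕ p * + p)
        ≡⟨ cong (λ ρ → (+ ρ + x ℤ./ℕ p * + p) - (+ (y ℤ.%ℕ p) + y ℤ./ℕ p * + p)) eq ⟩
      (+ (y ℤ.%ℕ p) + x ℤ./ℕ p * + p) - (+ (y ℤ.%ℕ p) + y ℤ./ℕ p * + p)
        ≡⟨ cancel (+ (y ℤ.%ℕ p)) (x ℤ./ℕ p) (y ℤ./ℕ p) (+ p) ⟩
      (x ℤ./ℕ p - y ℤ./ℕ p) * + p ∎)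
      where
      open ≡-Reasoning
      cancel : ∀ ρ a b q → (ρ + a * q) - (ρ + b * q) ≡ (a - b) * q
      cancel = solve-∀

    no-small-multiple : ∀ {n} → 0 ℕ.< n → n ℕ.< p → ¬ (p ℕ∣.∣ n)
    no-small-multiple {suc _} _ n<p p∣n = ℕP.<-irrefl refl (ℕP.≤-<-trans (ℕ∣.∣⇒≤ p∣n) n<p)

    -- Distinct numbers of size at most p/2 have incongruent squares modulo p,
    -- since p would divide (b - a)(a + b) with both factors in (0, p).
    squares-incongruent< : ∀ {a b} → a ℕ.< b → 2 ℕ.* b ℕ.≤ p → ¬ (+ p ∣ + (a ℕ.* a) - + (b ℕ.* b))
    squares-incongruent< {a} a<b 2b≤p p∣a²-b² with d , refl ← ℕP.m≤n⇒∃[o]m+o≡n (ℕP.<⇒≤ a<b) =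
      [ no-small-multiple 0<d (ℕP.≤-<-trans (ℕP.m≤n+m d a) b<p)
      , no-small-multiple (ℕP.<-≤-trans 0<d (ℕP.≤-trans (ℕP.m≤n+m d a) (ℕP.m≤n+m b a))) a+b<p
      ]′ (euclidsLemma d (a ℕ.+ (a ℕ.+ d)) p-prime p∣d[a+b])
      where
      b = a ℕ.+ d
      0<d : 0 ℕ.< d
      0<d = ℕP.n≢0⇒n>0 (λ { refl → ℕP.<-irrefl (sym (ℕP.+-identityʳ a)) a<b })
      2b≤p' : b ℕ.+ b ℕ.≤ p
      2b≤p' = subst (ℕ._≤ p) (cong (b ℕ.+_) (ℕP.+-identityʳ b)) 2b≤p
      b<p : b ℕ.< p
      b<p = ℕP.<-≤-trans (ℕP.m<n+m b (ℕP.<-≤-trans 0<d (ℕP.m≤n+m d a))) 2b≤p'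
      a+b<p : a ℕ.+ b ℕ.< p
      a+b<p = ℕP.<-≤-trans (ℕP.+-monoˡ-< b a<b) 2b≤p'
      p∣d[a+b] : p ℕ∣.∣ d ℕ.* (a ℕ.+ b)
      p∣d[a+b] = subst (p ℕ∣.∣_) (trans (cong ∣_∣ difference) (ℤP.∣-i∣≡∣i∣ (+ (d ℕ.* (a ℕ.+ b))))) (∣⇒∣ᵤ p∣a²-b²)
        where
        expand : ∀ a d → (a ℕ.+ d) ℕ.* (a ℕ.+ d) ≡ a ℕ.* a ℕ.+ d ℕ.* (a ℕ.+ (a ℕ.+ d))
        expand = ℕ-Ring.solve-∀
        cancel : ∀ u v → u - (u + v) ≡ - v
        cancel = solve-∀
        difference : + (a ℕ.* a) - + (b ℕ.* b) ≡ - + (d ℕ.* (a ℕ.+ b))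
        difference = begin
          + (a ℕ.* a) - + (b ℕ.* b)                 ≡⟨ cong (λ t → + (a ℕ.* a) - + t) (expand a d) ⟩
          + (a ℕ.* a) - + (a ℕ.* a ℕ.+ X)           ≡⟨ cong (λ t → + (a ℕ.* a) - t) (ℤP.pos-+ (a ℕ.* a) X) ⟩
          + (a ℕ.* a) - (+ (a ℕ.* a) + + X)         ≡⟨ cancel (+ (a ℕ.* a)) (+ X) ⟩
          - + X                                     ∎
          where
          open ≡-Reasoning
          X = d ℕ.* (a ℕ.+ b)

    squares-incongruent : ∀ {a b} → a ≢ b → 2 ℕ.* a ℕ.≤ p → 2 ℕ.* b ℕ.≤ p →
                          ¬ (+ p ∣ + (a ℕ.* a) - + (b ℕ.* b))
    squares-incongruent {a} {b} a≢b 2a≤p 2b≤p p∣a²-b² with ℕP.<-cmp a b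
    ... | tri< a<b _ _ = squares-incongruent< a<b 2b≤p p∣a²-b²
    ... | tri≈ _ a≡b _ = a≢b a≡b
    ... | tri> _ _ b<a = squares-incongruent< b<a 2a≤p
                           (subst (+ p ∣_) (swap (+ (a ℕ.* a)) (+ (b ℕ.* b))) (∣m⇒∣-m p∣a²-b²))
      where
      swap : ∀ u v → - (u - v) ≡ v - u
      swap = solve-∀

    h : ℕ
    h = p ℕ./ 2

    candidate : Fin (suc h) ⊎ Fin (suc h) → ℤ
    candidate (inj₁ a) = + (toℕ a ℕ.* toℕ a)
    candidate (inj₂ b) = - (+ 1 + + (toℕ b ℕ.* toℕ b))

    small : (a : Fin (suc h)) → 2 ℕ.* toℕ a ℕ.≤ p
    small a = ℕP.≤-trans (ℕP.*-monoʳ-≤ 2 (FinP.toℕ≤pred[n] a))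
                (subst (ℕ._≤ p) (ℕP.*-comm h 2) (ℕ÷.m/n*n≤m p 2))

    residue : ℤ → Fin p
    residue x = fromℕ< (ℤ÷.n%ℕd<d x p)

    p<2[1+h] : p ℕ.< suc h ℕ.+ suc h
    p<2[1+h] = begin-strict
      p                   ≡⟨ ℕ÷.m≡m%n+[m/n]*n p 2 ⟩
      p ℕ.% 2 ℕ.+ h ℕ.* 2 <⟨ ℕP.+-monoˡ-< (h ℕ.* 2) (ℕ÷.m%n<n p 2) ⟩
      2 ℕ.+ h ℕ.* 2       ≡⟨ identity h ⟩
      suc h ℕ.+ suc h     ∎
      where
      open ℕP.≤-Reasoning
      identity : ∀ h → 2 ℕ.+ h ℕ.* 2 ≡ suc h ℕ.+ suc h
      identity = ℕ-Ring.solve-∀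

    TwoSquaresPlusOne : Set
    TwoSquaresPlusOne = ∃₂ λ a b → 2 ℕ.* a ℕ.≤ p × 2 ℕ.* b ℕ.≤ p × p ℕ∣.∣ a ℕ.* a ℕ.+ b ℕ.* b ℕ.+ 1

    collision : ∀ u v → u ≢ v → + p ∣ candidate u - candidate v → TwoSquaresPlusOne
    collision (inj₁ a) (inj₁ a') a≢a' p∣ =
      ⊥-elim (squares-incongruent (λ eq → a≢a' (cong inj₁ (FinP.toℕ-injective eq))) (small a) (small a') p∣)
    collision (inj₂ b) (inj₂ b') b≢b' p∣ =
      ⊥-elim (squares-incongruent (λ eq → b≢b' (cong inj₂ (sym (FinP.toℕ-injective eq)))) (small b') (small b)
               (subst (+ p ∣_) (shift (+ (toℕ b ℕ.* toℕ b)) (+ (toℕ b' ℕ.* toℕ b'))) p∣))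
      where
      shift : ∀ u v → - (+ 1 + u) - - (+ 1 + v) ≡ v - u
      shift = solve-∀
    collision (inj₁ a) (inj₂ b) _ p∣ =
      toℕ a , toℕ b , small a , small b , ∣⇒∣ᵤ (subst (+ p ∣_) (sum (toℕ a) (toℕ b)) p∣)
      where
      sum : ∀ a b → + (a ℕ.* a) - - (+ 1 + + (b ℕ.* b)) ≡ + (a ℕ.* a ℕ.+ b ℕ.* b ℕ.+ 1)
      sum a b = trans (identity (+ (a ℕ.* a)) (+ (b ℕ.* b)))
                      (sym (trans (ℤP.pos-+ (a ℕ.* a ℕ.+ b ℕ.* b) 1)
                                  (cong (_+ + 1) (ℤP.pos-+ (a ℕ.* a) (b ℕ.* b)))))
        where
        identity : ∀ u v → u - - (+ 1 + v) ≡ u + v + + 1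
        identity = solve-∀
    collision (inj₂ b) (inj₁ a) b≢a p∣ =
      collision (inj₁ a) (inj₂ b) (λ eq → b≢a (sym eq))
        (subst (+ p ∣_) (swap (candidate (inj₂ b)) (candidate (inj₁ a))) (∣m⇒∣-m p∣))
      where
      swap : ∀ u v → - (u - v) ≡ v - u
      swap = solve-∀

    two-squares-plus-one : TwoSquaresPlusOne
    two-squares-plus-one
      with i , j , i<j , same ← FinP.pigeonhole p<2[1+h] (residue ∘ candidate ∘ splitAt (suc h)) =
      collision (splitAt (suc h) i) (splitAt (suc h) j) split-distinct
        (same-residue (candidate (splitAt (suc h) i)) (candidate (splitAt (suc h) j))
          (trans (sym (FinP.toℕ-fromℕ< _)) (trans (cong toℕ same) (FinP.toℕ-fromℕ< _))))
      where
      split-distinct : splitAt (suc h) i ≢ splitAt (suc h) j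
      split-distinct eq = FinP.<⇒≢ i<j (trans (sym (FinP.join-splitAt (suc h) (suc h) i))
                            (trans (cong (join (suc h) (suc h)) eq) (FinP.join-splitAt (suc h) (suc h) j)))

    small-multiple : TwoSquaresPlusOne → ∃ λ m → 0 ℕ.< m × m ℕ.< p × FourSquares (m ℕ.* p)
    small-multiple (a , b , 2a≤p , 2b≤p , ℕ∣.divides m N≡mp) =
      m , 0<m , m<p , ⟨ + a , + b , + 1 , 0ℤ ⟩ , trans (‖‖≡‖‖ₙ ⟨ + a , + b , + 1 , 0ℤ ⟩) (cong +_ norm≡mp)
      where
      N = a ℕ.* a ℕ.+ b ℕ.* b ℕ.+ 1
      norm≡mp : N ℕ.+ 0 ≡ m ℕ.* p
      norm≡mp = trans (ℕP.+-identityʳ N) N≡mp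
      0<m : 0 ℕ.< m
      0<m = ℕP.n≢0⇒n>0 λ { refl → ℕP.1+n≢0 (trans (ℕP.+-comm 1 (a ℕ.* a ℕ.+ b ℕ.* b)) N≡mp) }
      m<p : m ℕ.< p
      m<p = ℕP.*-cancelʳ-< p m p (subst (ℕ._< p ℕ.* p) N≡mp (two-squares-plus-one-bound a b 2a≤p 2b≤p 2≤p))

  prime-four-squares : ∀ {p} → Prime p → FourSquares p
  prime-four-squares p-prime =
    let open Pigeonhole p-prime
        m , 0<m , m<p , m·p = small-multiple two-squares-plus-one
    in Descent.descent p-prime m 0<m m<p m·p

  product-four-squares : ∀ {a b} → FourSquares a → FourSquares b → FourSquares (a ℕ.* b)
  product-four-squares {a} {b} (x , ‖x‖≡a) (y , ‖y‖≡b) =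
    x ⊗ y , trans (sym (‖‖-⊗ x y)) (trans (cong₂ _*_ ‖x‖≡a ‖y‖≡b) (sym (ℤP.pos-* a b)))

  lagrange : ∀ n → FourSquares n
  lagrange = <-rec FourSquares step
    where
    step : ∀ n → (∀ {m} → m ℕ.< n → FourSquares m) → FourSquares n
    step zero          _ = ⟨ 0ℤ , 0ℤ , 0ℤ , 0ℤ ⟩ , refl
    step (suc zero)    _ = ⟨ + 1 , 0ℤ , 0ℤ , 0ℤ ⟩ , refl
    step n@(suc (suc _)) rec with composite? n
    ... | no ¬composite = prime-four-squares (prime ¬composite)
    ... | yes (composite {d} d<n (ℕ∣.divides q n≡qd)) =
      subst FourSquares (sym n≡qd) (product-four-squares (rec q<n) (rec d<n))
      where
      q<n : q ℕ.< n
      q<n = subst (q ℕ.<_) (sym n≡qd)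
              (ℕP.m<m*n q d {{ℕ.≢-nonZero λ { refl → ℕP.1+n≢0 n≡qd }}} (ℕ.nonTrivial⇒n>1 d))

module IntegersInRationals where

  private
    ℤtoℚᵘ : ℤ → ℚᵘ.ℚᵘ
    ℤtoℚᵘ a = ℚᵘ.mkℚᵘ a 0

    toℚᵘ-ℤtoℚ : ∀ a → ℚ.toℚᵘ (ℤtoℚ a) ℚᵘ.≃ ℤtoℚᵘ a
    toℚᵘ-ℤtoℚ a = ℚP.toℚᵘ-fromℚᵘ (ℤtoℚᵘ a)

  ℤtoℚ-injective : ∀ {a b} → ℤtoℚ a ≡ ℤtoℚ b → a ≡ b
  ℤtoℚ-injective {a} {b} eq with ℚP.fromℚᵘ-injective {ℤtoℚᵘ a} {ℤtoℚᵘ b} eq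
  ... | ℚᵘ.*≡* a*1≡b*1 = trans (sym (ℤP.*-identityʳ a)) (trans a*1≡b*1 (ℤP.*-identityʳ b))

  ℤtoℚ-+ : ∀ a b → ℤtoℚ (a ℤ.+ b) ≡ ℤtoℚ a ℚ.+ ℤtoℚ b
  ℤtoℚ-+ a b = ℚP.toℚᵘ-injective (ℚᵘP.≃-trans (toℚᵘ-ℤtoℚ (a ℤ.+ b)) (ℚᵘP.≃-sym (ℚᵘP.≃-trans
    (ℚP.toℚᵘ-homo-+ (ℤtoℚ a) (ℤtoℚ b))
    (ℚᵘP.≃-trans (ℚᵘP.+-cong (toℚᵘ-ℤtoℚ a) (toℚᵘ-ℤtoℚ b)) (ℚᵘ.*≡* (denominators a b))))))
    where
    denominators : ∀ a b → (a ℤ.* + 1 ℤ.+ b ℤ.* + 1) ℤ.* + 1 ≡ (a ℤ.+ b) ℤ.* (+ 1 ℤ.* + 1)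
    denominators = solve-∀

  ℤtoℚ-* : ∀ a b → ℤtoℚ (a ℤ.* b) ≡ ℤtoℚ a ℚ.* ℤtoℚ b
  ℤtoℚ-* a b = ℚP.toℚᵘ-injective (ℚᵘP.≃-trans (toℚᵘ-ℤtoℚ (a ℤ.* b)) (ℚᵘP.≃-sym (ℚᵘP.≃-trans
    (ℚP.toℚᵘ-homo-* (ℤtoℚ a) (ℤtoℚ b))
    (ℚᵘP.≃-trans (ℚᵘP.*-cong (toℚᵘ-ℤtoℚ a) (toℚᵘ-ℤtoℚ b)) (ℚᵘ.*≡* (denominators a b))))))
    where
    denominators : ∀ a b → (a ℤ.* b) ℤ.* + 1 ≡ (a ℤ.* b) ℤ.* (+ 1 ℤ.* + 1)
    denominators = solve-∀

module SeparablePolynomials where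
  open IntegersInRationals
  open CommutativeSemigroupProperties
         (CommutativeMonoid.commutativeSemigroup ℚP.+-0-commutativeMonoid) using (interchange)
  module ℕΣ = MonoidSum ℕP.+-0-commutativeMonoid

  ∑-cong : ∀ n {f g : Fin n → ℚ} → (∀ i → f i ≡ g i) → ∑ n f ≡ ∑ n g
  ∑-cong zero    _   = refl
  ∑-cong (suc n) f≗g = cong₂ ℚ._+_ (f≗g zero) (∑-cong n (λ i → f≗g (suc i)))

  ∑-+ : ∀ n (f g : Fin n → ℚ) → ∑ n f ℚ.+ ∑ n g ≡ ∑ n (λ i → f i ℚ.+ g i)
  ∑-+ zero    _ _ = ℚP.+-identityˡ 0ℚ
  ∑-+ (suc n) f g = trans (interchange (f zero) _ (g zero) _)
                          (cong (f zero ℚ.+ g zero ℚ.+_) (∑-+ n (λ i → f (suc i)) (λ i → g (suc i))))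

  ∑-ℕtoℚ : ∀ n (f : Fin n → ℕ) → ∑ n (λ i → ℕtoℚ (f i)) ≡ ℕtoℚ (ℕΣ.sum f)
  ∑-ℕtoℚ zero    _ = refl
  ∑-ℕtoℚ (suc n) f = trans (cong (ℕtoℚ (f zero) ℚ.+_) (∑-ℕtoℚ n (λ i → f (suc i))))
                           (sym (trans (cong ℤtoℚ (ℤP.pos-+ (f zero) rest)) (ℤtoℚ-+ (+ f zero) (+ rest))))
    where rest = ℕΣ.sum (λ i → f (suc i))

  diagonal : ∀ {k} → (Fin k → ℚ) → Fin k → Fin k → ℚ
  diagonal c zero    zero    = c zero
  diagonal _ zero    (suc _) = 0ℚ
  diagonal _ (suc _) zero    = 0ℚ
  diagonal c (suc i) (suc j) = diagonal (λ l → c (suc l)) i j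

  diagonal-row : ∀ n (c X : Fin n → ℚ) i → ∑ n (λ j → diagonal c i j ℚ.* (X i ℚ.* X j)) ≡ c i ℚ.* (X i ℚ.* X i)
  diagonal-row (suc n) c X zero = begin
    c zero ℚ.* (X zero ℚ.* X zero) ℚ.+ ∑ n (λ j → 0ℚ ℚ.* (X zero ℚ.* X (suc j)))
      ≡⟨ cong (c zero ℚ.* (X zero ℚ.* X zero) ℚ.+_) (∑-cong n (λ j → ℚP.*-zeroˡ (X zero ℚ.* X (suc j)))) ⟩
    c zero ℚ.* (X zero ℚ.* X zero) ℚ.+ ∑ n (λ _ → 0ℚ)
      ≡⟨ cong (c zero ℚ.* (X zero ℚ.* X zero) ℚ.+_) (∑-zero n) ⟩
    c zero ℚ.* (X zero ℚ.* X zero) ℚ.+ 0ℚ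
      ≡⟨ ℚP.+-identityʳ _ ⟩
    c zero ℚ.* (X zero ℚ.* X zero) ∎
    where
    open ≡-Reasoning
    ∑-zero : ∀ n → ∑ n (λ _ → 0ℚ) ≡ 0ℚ
    ∑-zero zero    = refl
    ∑-zero (suc n) = trans (cong (0ℚ ℚ.+_) (∑-zero n)) (ℚP.+-identityˡ 0ℚ)
  diagonal-row (suc n) c X (suc i) =
    trans (cong₂ ℚ._+_ (ℚP.*-zeroˡ (X (suc i) ℚ.* X zero)) (diagonal-row n (λ l → c (suc l)) (λ l → X (suc l)) i))
          (ℚP.+-identityˡ _)

  record NatQuadratic : Set where
    field
      lead linear   : ℤ
      value         : ℤ → ℕ
      value-correct : ∀ w → lead ℤ.* (w ℤ.* w) ℤ.+ linear ℤ.* w ≡ + value w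
  open NatQuadratic public

  separable : ∀ {k} → (Fin k → NatQuadratic) → QuadPoly k
  separable q = record
    { quad  = diagonal (λ i → ℤtoℚ (lead (q i)))
    ; lin   = λ i → ℤtoℚ (linear (q i))
    ; const = 0ℚ
    }

  separable-value : ∀ {k} → (Fin k → NatQuadratic) → (Fin k → ℤ) → ℕ
  separable-value q x = ℕΣ.sum (λ i → value (q i) (x i))

  eval-separable : ∀ {k} (q : Fin k → NatQuadratic) x → eval (separable q) x ≡ ℕtoℚ (separable-value q x)
  eval-separable {k} q x = begin
    eval (separable q) x
      ≡⟨ cong (λ s → s ℚ.+ ∑ k (λ i → b i ℚ.* X i) ℚ.+ 0ℚ) (∑-cong k (λ i → diagonal-row k a X i)) ⟩
    ∑ k (λ i → a i ℚ.* (X i ℚ.* X i)) ℚ.+ ∑ k (λ i → b i ℚ.* X i) ℚ.+ 0ℚ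
      ≡⟨ trans (ℚP.+-identityʳ _) (∑-+ k (λ i → a i ℚ.* (X i ℚ.* X i)) (λ i → b i ℚ.* X i)) ⟩
    ∑ k (λ i → a i ℚ.* (X i ℚ.* X i) ℚ.+ b i ℚ.* X i)
      ≡⟨ ∑-cong k term ⟩
    ∑ k (λ i → ℕtoℚ (value (q i) (x i)))
      ≡⟨ ∑-ℕtoℚ k (λ i → value (q i) (x i)) ⟩
    ℕtoℚ (separable-value q x) ∎
    where
    open ≡-Reasoning
    a b X : Fin k → ℚ
    a i = ℤtoℚ (lead (q i))
    b i = ℤtoℚ (linear (q i))
    X i = ℤtoℚ (x i)
    term : ∀ i → a i ℚ.* (X i ℚ.* X i) ℚ.+ b i ℚ.* X i ≡ ℕtoℚ (value (q i) (x i))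
    term i = begin
      a i ℚ.* (X i ℚ.* X i) ℚ.+ b i ℚ.* X i
        ≡⟨ cong₂ ℚ._+_ (cong (a i ℚ.*_) (ℤtoℚ-* (x i) (x i))) refl ⟨
      a i ℚ.* ℤtoℚ (x i ℤ.* x i) ℚ.+ b i ℚ.* X i
        ≡⟨ cong₂ ℚ._+_ (ℤtoℚ-* (lead (q i)) _) (ℤtoℚ-* (linear (q i)) (x i)) ⟨
      ℤtoℚ (lead (q i) ℤ.* (x i ℤ.* x i)) ℚ.+ ℤtoℚ (linear (q i) ℤ.* x i)
        ≡⟨ ℤtoℚ-+ (lead (q i) ℤ.* (x i ℤ.* x i)) (linear (q i) ℤ.* x i) ⟨
      ℤtoℚ (lead (q i) ℤ.* (x i ℤ.* x i) ℤ.+ linear (q i) ℤ.* x i)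
        ≡⟨ cong ℤtoℚ (value-correct (q i) (x i)) ⟩
      ℕtoℚ (value (q i) (x i)) ∎

module MissingValue (t : ℕ) where
  open FourSquares using (ℤ⁴; ⟨_,_,_,_⟩; ‖_‖ₙ; ‖‖≡‖‖ₙ; square≡∣∣²; lagrange)
  open SeparablePolynomials
  open IntegersInRationals using (ℤtoℚ-injective; ℤtoℚ-+)

  z A M : ℕ
  z = suc t
  A = suc z
  M = A ℕ.+ z

  open import Data.Integer using (_+_; _*_; _-_; -_)

  square : ℕ → NatQuadratic
  square c = record
    { lead = + c ; linear = 0ℤ ; value = λ w → c ℕ.* (∣ w ∣ ℕ.* ∣ w ∣) ; value-correct = correct }
    where
    correct : ∀ w → + c * (w * w) + 0ℤ * w ≡ + (c ℕ.* (∣ w ∣ ℕ.* ∣ w ∣))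
    correct w = begin
      + c * (w * w) + 0ℤ * w        ≡⟨ cong (λ v → + c * (w * w) + v) (ℤP.*-zeroˡ w) ⟩
      + c * (w * w) + 0ℤ            ≡⟨ ℤP.+-identityʳ (+ c * (w * w)) ⟩
      + c * (w * w)                 ≡⟨ cong (+ c *_) (square≡∣∣² w) ⟩
      + c * + (∣ w ∣ ℕ.* ∣ w ∣)     ≡⟨ ℤP.pos-* c (∣ w ∣ ℕ.* ∣ w ∣) ⟨
      + (c ℕ.* (∣ w ∣ ℕ.* ∣ w ∣))   ∎
      where open ≡-Reasoning

  -- g(w) = A w² + (1 - A) w = A w (w - 1) + w, as a natural number.
  g : ℤ → ℕ
  g (+ zero)   = 0
  g (+ suc n)  = A ℕ.* (suc n ℕ.* n) ℕ.+ suc n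
  g -[1+ n ]   = suc n ℕ.* (z ℕ.* suc (suc n) ℕ.+ suc n)

  g-correct : ∀ w → + A * (w * w) + (+ 1 - + A) * w ≡ + g w
  g-correct (+ zero) = identity (+ A)
    where
    identity : ∀ a → a * (+ 0 * + 0) + (+ 1 - a) * + 0 ≡ + 0
    identity = solve-∀
  g-correct (+ suc n) = begin
    + A * (+ suc n * + suc n) + (+ 1 - + A) * + suc n ≡⟨ identity (+ A) (+ n) ⟩
    + A * (+ suc n * + n) + + suc n                   ≡⟨ cong (λ v → + A * v + + suc n) (ℤP.pos-* (suc n) n) ⟨
    + A * + (suc n ℕ.* n) + + suc n                   ≡⟨ cong (_+ + suc n) (ℤP.pos-* A (suc n ℕ.* n)) ⟨
    + (A ℕ.* (suc n ℕ.* n)) + + suc n                 ≡⟨ ℤP.pos-+ (A ℕ.* (suc n ℕ.* n)) (suc n) ⟨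
    + g (+ suc n)                                     ∎
    where
    open ≡-Reasoning
    identity : ∀ a n → a * ((+ 1 + n) * (+ 1 + n)) + (+ 1 - a) * (+ 1 + n) ≡ a * ((+ 1 + n) * n) + (+ 1 + n)
    identity = solve-∀
  g-correct -[1+ n ] = begin
    + A * (-[1+ n ] * -[1+ n ]) + (+ 1 - + A) * -[1+ n ] ≡⟨ identity (+ z) (+ n) ⟩
    + suc n * (+ z * + suc (suc n) + + suc n)
      ≡⟨ cong (λ v → + suc n * (v + + suc n)) (ℤP.pos-* z (suc (suc n))) ⟨
    + suc n * (+ (z ℕ.* suc (suc n)) + + suc n)
      ≡⟨ cong (+ suc n *_) (ℤP.pos-+ (z ℕ.* suc (suc n)) (suc n)) ⟨
    + suc n * + (z ℕ.* suc (suc n) ℕ.+ suc n)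
      ≡⟨ ℤP.pos-* (suc n) (z ℕ.* suc (suc n) ℕ.+ suc n) ⟨
    + g -[1+ n ]                                         ∎
    where
    open ≡-Reasoning
    identity : ∀ z n → (+ 1 + z) * (- (+ 1 + n) * - (+ 1 + n)) + (+ 1 - (+ 1 + z)) * - (+ 1 + n)
                       ≡ (+ 1 + n) * (z * (+ 2 + n) + (+ 1 + n))
    identity = solve-∀

  gap-quadratic : NatQuadratic
  gap-quadratic = record { lead = + A ; linear = + 1 - + A ; value = g ; value-correct = g-correct }

  coordinate : Fin (5 ℕ.+ t) → NatQuadratic
  coordinate zero                                = square A
  coordinate (suc zero)                          = square A
  coordinate (suc (suc zero))                    = square A
  coordinate (suc (suc (suc zero)))              = square A
  coordinate (suc (suc (suc (suc zero))))        = square M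
  coordinate (suc (suc (suc (suc (suc _)))))     = gap-quadratic

  F : QuadPoly (5 ℕ.+ t)
  F = separable coordinate

  F-value : (Fin (5 ℕ.+ t) → ℤ) → ℕ
  F-value = separable-value coordinate

  point : ℤ⁴ → ℤ → (Fin t → ℤ) → Fin (5 ℕ.+ t) → ℤ
  point ⟨ s₁ , _ , _ , _ ⟩ _ _ zero                          = s₁
  point ⟨ _ , s₂ , _ , _ ⟩ _ _ (suc zero)                    = s₂
  point ⟨ _ , _ , s₃ , _ ⟩ _ _ (suc (suc zero))              = s₃
  point ⟨ _ , _ , _ , s₄ ⟩ _ _ (suc (suc (suc zero)))        = s₄
  point _                  u _ (suc (suc (suc (suc zero))))  = u
  point _                  _ w (suc (suc (suc (suc (suc i))))) = w i

  Σg : ∀ {n} → (Fin n → ℤ) → ℕ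
  Σg w = ℕΣ.sum (λ i → g (w i))

  F-value-point : ∀ s u w → F-value (point s u w) ≡ A ℕ.* ‖ s ‖ₙ ℕ.+ M ℕ.* (∣ u ∣ ℕ.* ∣ u ∣) ℕ.+ Σg w
  F-value-point ⟨ s₁ , s₂ , s₃ , s₄ ⟩ u w =
    regroup A M (∣ s₁ ∣ ℕ.* ∣ s₁ ∣) (∣ s₂ ∣ ℕ.* ∣ s₂ ∣) (∣ s₃ ∣ ℕ.* ∣ s₃ ∣) (∣ s₄ ∣ ℕ.* ∣ s₄ ∣)
                (∣ u ∣ ℕ.* ∣ u ∣) (Σg w)
    where
    regroup : ∀ A M a b c d U R → A ℕ.* a ℕ.+ (A ℕ.* b ℕ.+ (A ℕ.* c ℕ.+ (A ℕ.* d ℕ.+ (M ℕ.* U ℕ.+ R))))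
                                  ≡ A ℕ.* (a ℕ.+ b ℕ.+ c ℕ.+ d) ℕ.+ M ℕ.* U ℕ.+ R
    regroup = ℕ-Ring.solve-∀

  AvoidsGap : ℕ → Set
  AvoidsGap n = n ℕ.≤ t ⊎ A ℕ.≤ n

  avoids-z : ∀ {n} → AvoidsGap n → n ≢ z
  avoids-z (inj₁ n≤t) refl = ℕP.<-irrefl refl n≤t
  avoids-z (inj₂ A≤n) refl = ℕP.<-irrefl refl A≤n

  avoids-+ : ∀ {a n} → a ≡ 0 ⊎ A ℕ.≤ a → AvoidsGap n → AvoidsGap (a ℕ.+ n)
  avoids-+ (inj₁ refl) avoids = avoids
  avoids-+ {a} {n} (inj₂ A≤a) _ = inj₂ (ℕP.≤-trans A≤a (ℕP.m≤m+n a n))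

  multiple-gap : ∀ {c} s → A ℕ.≤ c → c ℕ.* s ≡ 0 ⊎ A ℕ.≤ c ℕ.* s
  multiple-gap {c} zero    _   = inj₁ (ℕP.*-zeroʳ c)
  multiple-gap {c} (suc s) A≤c = inj₂ (ℕP.≤-trans A≤c (ℕP.m≤m*n c (suc s)))

  g-gap : ∀ w → g w ℕ.≤ 1 ⊎ A ℕ.≤ g w
  g-gap (+ zero)          = inj₁ z≤n
  g-gap (+ suc zero)      = inj₁ (ℕP.≤-reflexive (cong (ℕ._+ 1) (ℕP.*-zeroʳ A)))
  g-gap (+ suc (suc n))   = inj₂ (ℕP.≤-trans (ℕP.m≤m*n A (suc (suc n) ℕ.* suc n)) (ℕP.m≤m+n _ (suc (suc n))))
  g-gap -[1+ n ]          = inj₂ (ℕP.≤-trans A≤ (ℕP.m≤n*m _ (suc n)))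
    where
    A≤ : A ℕ.≤ z ℕ.* suc (suc n) ℕ.+ suc n
    A≤ = ℕP.≤-trans (ℕP.≤-reflexive (ℕP.+-comm 1 z)) (ℕP.+-mono-≤ (ℕP.m≤m*n z (suc (suc n))) (s≤s z≤n))

  Σg-gap : ∀ n (w : Fin n → ℤ) → Σg w ℕ.≤ n ⊎ A ℕ.≤ Σg w
  Σg-gap zero    _ = inj₁ z≤n
  Σg-gap (suc n) w with g-gap (w zero) | Σg-gap n (λ i → w (suc i))
  ... | inj₁ g≤1 | inj₁ rest≤n = inj₁ (ℕP.+-mono-≤ g≤1 rest≤n)
  ... | inj₂ A≤g | _           = inj₂ (ℕP.≤-trans A≤g (ℕP.m≤m+n _ _))
  ... | inj₁ _   | inj₂ A≤rest = inj₂ (ℕP.≤-trans A≤rest (ℕP.m≤n+m _ _))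

  F-value≢z : ∀ x → F-value x ≢ z
  F-value≢z x = avoids-z
    (avoids-+ (multiple-gap (sq (x zero)) ℕP.≤-refl)
    (avoids-+ (multiple-gap (sq (x (suc zero))) ℕP.≤-refl)
    (avoids-+ (multiple-gap (sq (x (suc (suc zero)))) ℕP.≤-refl)
    (avoids-+ (multiple-gap (sq (x (suc (suc (suc zero))))) ℕP.≤-refl)
    (avoids-+ (multiple-gap (sq (x (suc (suc (suc (suc zero)))))) (ℕP.m≤m+n A z))
    (Σg-gap t w))))))
    where
    sq : ℤ → ℕ
    sq v = ∣ v ∣ ℕ.* ∣ v ∣
    w : Fin t → ℤ
    w i = x (suc (suc (suc (suc (suc i)))))

  ones : ∀ n → ℕ → Fin n → ℤ
  ones (suc n) zero    _       = 0ℤ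
  ones (suc n) (suc r) zero    = + 1
  ones (suc n) (suc r) (suc i) = ones n r i

  Σg-ones : ∀ n r → r ℕ.≤ n → Σg (ones n r) ≡ r
  Σg-ones zero    zero    _         = refl
  Σg-ones (suc n) zero    _         = ℕΣ.sum-replicate-zero (suc n)
  Σg-ones (suc n) (suc r) (s≤s r≤n) = cong₂ ℕ._+_ (cong (ℕ._+ 1) (ℕP.*-zeroʳ A)) (Σg-ones n r r≤n)

  four-squares : ∀ q → ∃ λ s → ‖ s ‖ₙ ≡ q
  four-squares q = let s , ‖s‖≡q = lagrange q in s , ℤP.+-injective (trans (sym (‖‖≡‖‖ₙ s)) ‖s‖≡q)

  value-small-residue : ∀ r q → r ℕ.≤ t → ∃ λ x → F-value x ≡ r ℕ.+ q ℕ.* A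
  value-small-residue r q r≤t =
    let s , ‖s‖≡q = four-squares q
    in point s 0ℤ (ones t r) , (begin
      F-value (point s 0ℤ (ones t r))             ≡⟨ F-value-point s 0ℤ (ones t r) ⟩
      A ℕ.* ‖ s ‖ₙ ℕ.+ M ℕ.* 0 ℕ.+ Σg (ones t r)  ≡⟨ cong₂ (λ a b → A ℕ.* a ℕ.+ M ℕ.* 0 ℕ.+ b)
                                                           ‖s‖≡q (Σg-ones t r r≤t) ⟩
      A ℕ.* q ℕ.+ M ℕ.* 0 ℕ.+ r                   ≡⟨ rearrange A M q r ⟩
      r ℕ.+ q ℕ.* A                               ∎)
    where
    open ≡-Reasoning
    rearrange : ∀ A M q r → A ℕ.* q ℕ.+ M ℕ.* 0 ℕ.+ r ≡ r ℕ.+ q ℕ.* A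
    rearrange = ℕ-Ring.solve-∀

  value-residue-z : ∀ q → ∃ λ x → F-value x ≡ z ℕ.+ suc q ℕ.* A
  value-residue-z q =
    let s , ‖s‖≡q = four-squares q
    in point s (+ 1) (ones t 0) , (begin
      F-value (point s (+ 1) (ones t 0))          ≡⟨ F-value-point s (+ 1) (ones t 0) ⟩
      A ℕ.* ‖ s ‖ₙ ℕ.+ M ℕ.* 1 ℕ.+ Σg (ones t 0)  ≡⟨ cong₂ (λ a b → A ℕ.* a ℕ.+ M ℕ.* 1 ℕ.+ b)
                                                           ‖s‖≡q (Σg-ones t 0 z≤n) ⟩
      A ℕ.* q ℕ.+ M ℕ.* 1 ℕ.+ 0                   ≡⟨ rearrange z q ⟩
      z ℕ.+ suc q ℕ.* A                           ∎)
    where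
    open ≡-Reasoning
    rearrange : ∀ z q → suc z ℕ.* q ℕ.+ (suc z ℕ.+ z) ℕ.* 1 ℕ.+ 0 ≡ z ℕ.+ suc q ℕ.* suc z
    rearrange = ℕ-Ring.solve-∀

  F-value-onto : ∀ n → n ≢ z → ∃ λ x → F-value x ≡ n
  F-value-onto n n≢z = by-division (n ℕ.% A) (n ℕ./ A) (ℕ÷.m%n<n n A) (sym (ℕ÷.m≡m%n+[m/n]*n n A))
    where
    by-division : ∀ r q → r ℕ.< A → r ℕ.+ q ℕ.* A ≡ n → ∃ λ x → F-value x ≡ n
    by-division r q r<A r+qA≡n with r ℕ.≟ z
    ... | no r≢z =
      let x , Fx≡r+qA = value-small-residue r q (ℕP.≤-pred (ℕP.≤∧≢⇒< (ℕP.≤-pred r<A) r≢z))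
      in x , trans Fx≡r+qA r+qA≡n
    ... | yes refl with q
    ...   | zero   = ⊥-elim (n≢z (trans (sym r+qA≡n) (ℕP.+-identityʳ z)))
    ...   | suc q′ = let x , Fx≡z+qA = value-residue-z q′ in x , trans Fx≡z+qA r+qA≡n

  F-quadratic : IsQuadratic F
  F-quadratic = zero , zero , λ 2A≡0 →
    ℕP.1+n≢0 (ℤP.+-injective (ℤtoℚ-injective {+ A + + A} {0ℤ} (trans (ℤtoℚ-+ (+ A) (+ A)) 2A≡0)))

  F-natural : ∀ x → ∃ λ n → eval F x ≡ ℕtoℚ n
  F-natural x = F-value x , eval-separable coordinate x

  F-represents : ∀ n → n ≢ z → Represents F n
  F-represents n n≢z =
    let x , Fx≡n = F-value-onto n n≢z in x , trans (eval-separable coordinate x) (cong ℕtoℚ Fx≡n)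

  F-misses-z : ¬ Represents F z
  F-misses-z (x , Fx≡z) =
    F-value≢z x (ℤP.+-injective (ℤtoℚ-injective (trans (sym (eval-separable coordinate x)) Fx≡z)))

proposition1p4 : (𝒵 𝒴 : ℕ → Set)
    → ((n : ℕ) → 𝒵 n → 0 < n)
    → ((n : ℕ) → 𝒴 n → 𝒵 n)
    → (∃ λ (z : ℕ) → 𝒵 z × ¬ 𝒴 z)
    → ∃ λ (k : ℕ) → ∃ λ (f : QuadPoly k) →
        IsQuadratic f × NormalizedTotallyPositive f
        × ((n : ℕ) → 𝒴 n → Represents f n)
        × ¬ ((n : ℕ) → 𝒵 n → Represents f n)
proposition1p4 𝒵 𝒴 positive _ (zero , 0∈𝒵 , _) = ⊥-elim (ℕP.<-irrefl refl (positive 0 0∈𝒵))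
proposition1p4 𝒵 𝒴 _ _ (suc t , z∈𝒵 , z∉𝒴) =
  5 ℕ.+ t , F , F-quadratic , (F-natural , F-represents 0 (λ ())) ,
  (λ n n∈𝒴 → F-represents n (λ { refl → z∉𝒴 n∈𝒴 })) ,
  (λ represents-𝒵 → F-misses-z (represents-𝒵 z z∈𝒵))
  where open MissingValue t
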